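{- Let $m$ be a positive integer, $n=3m$, and let $\delta\in\mathbb{F}_{2^n}$ satisfy ${\rm Tr}_m^{3m}(\delta)=0$. Let $F(X)=(X^{2^m}+X+\delta)^{2^{2m+1}+2^m}+(X^{2^m}+X+\delta)^{2^{2m}+2^{m+1}}+X$, viewed as a function $\mathbb{F}_{2^n}\to\mathbb{F}_{2^n}$. Then $F$ is P$c$N for every $c\in\mathbb{F}_{2^m}\setminus\{1\}$.
   Context: ${\rm Tr}_m^{3m}(X)=X+X^{2^m}+X^{2^{2m}}$ is the relative trace from $\mathbb{F}_{2^{3m}}$ to $\mathbb{F}_{2^m}$. For $F:\mathbb{F}_q\to\mathbb{F}_q$ and $a,b,c\in\mathbb{F}_q$, let ${}_c\Delta_F(a,b)$ be the number of $X\in\mathbb{F}_q$ with $F(X+a)-cF(X)=b$. The $c$-differential uniformity of $F$ is ${}_c\Delta_F=\max\{{}_c\Delta_F(a,b): a,b\in\mathbb{F}_q,\ a\neq 0 \text{ if } c=1\}$. $F$ is perfect $c$-nonlinear (P$c$N) if ${}_c\Delta_F=1$. -}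

module Defs where

open import Level using (0ℓ)
open import Data.Nat as ℕ using (ℕ; zero; suc; _⊔_)
open import Data.Fin using (Fin)
open import Data.List using (List; []; _∷_; foldr; concatMap; map; filter; length; allFin)
open import Data.Product using (∃; _×_; _,_)
open import Relation.Nullary using (¬_; yes; no)
open import Relation.Binary.PropositionalEquality using (_≡_; _≢_)
open import Relation.Binary.Definitions using (DecidableEquality)
open import Algebra.Structures using (IsCommutativeRing)
open import Function.Bundles using (_↔_; Inverse)

-- A finite field with exactly q elements (propositional equality as the field equality).
-- Any two finite fields of the same order are isomorphic, so this is F_q.
record FiniteField (q : ℕ) : Set₁ where
  infixl 6 _+_ _-_
  infixl 7 _*_
  field
    Carrier  : Set
    _+_ _*_  : Carrier → Carrier → Carrier
    -_       : Carrier → Carrier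
    0# 1#    : Carrier
    isCommutativeRing : IsCommutativeRing _≡_ _+_ _*_ -_ 0# 1#
    0≢1      : 0# ≢ 1#
    inverse  : ∀ x → x ≢ 0# → ∃ λ y → x * y ≡ 1#
    _≟_      : DecidableEquality Carrier
    enum     : Fin q ↔ Carrier

  _-_ : Carrier → Carrier → Carrier
  x - y = x + (- y)

  _^_ : Carrier → ℕ → Carrier
  x ^ zero  = 1#
  x ^ suc n = x * (x ^ n)

  elements : List Carrier
  elements = map (Inverse.to enum) (allFin q)

  countSol : (Carrier → Carrier) → Carrier → ℕ
  countSol P b = length (filter (λ X → P X ≟ b) elements)

  cΔat : (Carrier → Carrier) → Carrier → Carrier → Carrier → ℕ
  cΔat F c a b = countSol (λ X → F (X + a) - c * F X) b

  admissible : Carrier → List (Carrier × Carrier)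
  admissible c = concatMap (λ a → map (λ b → (a , b)) elements) (filter ok elements)
    where
    ok : (a : Carrier) → Relation.Nullary.Dec (¬ (c ≡ 1# × a ≡ 0#))
    ok a with c ≟ 1# | a ≟ 0#
    ... | yes p | yes r = no (λ h → h (p , r))
    ... | no p  | _     = yes (λ { (p' , _) → p p' })
    ... | _     | no r  = yes (λ { (_ , r') → r r' })

  cDU : (Carrier → Carrier) → Carrier → ℕ
  cDU F c = foldr (λ { (a , b) acc → cΔat F c a b ⊔ acc }) 0 (admissible c)

  PcN : (Carrier → Carrier) → Carrier → Set
  PcN F c = cDU F c ≡ 1

  Tr : ℕ → Carrier → Carrier
  Tr m x = x + x ^ (2 ℕ.^ m) + x ^ (2 ℕ.^ (2 ℕ.* m))

  InSub : ℕ → Carrier → Set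
  InSub m c = c ^ (2 ℕ.^ m) ≡ c

module _ {q : ℕ} (K : FiniteField q) where
  open FiniteField K

  thmF : ℕ → Carrier → Carrier → Carrier
  thmF m δ X =
    (L ^ (2 ℕ.^ (2 ℕ.* m ℕ.+ 1) ℕ.+ 2 ℕ.^ m))
      + (L ^ (2 ℕ.^ (2 ℕ.* m) ℕ.+ 2 ℕ.^ (m ℕ.+ 1))) + X
    where
    L : Carrier
    L = (X ^ (2 ℕ.^ m)) + X + δ

{-# OPTIONS --safe #-}
-- Let σ(x) = x^(2^m), an automorphism of order 3 with fixed field F_(2^m), and
-- L(X) = σ(X) + X + δ.  Then F(X) = P(L(X)) + X with P(y) = σ²(y)² σ(y) + σ(y)² σ²(y).
-- L takes values of trace Tr(δ) = 0, and on trace-zero y (where σ(y) = y + σ²(y)) P is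
-- σ-invariant, so F(X + a) - c F(X) = B(X) + (1 + c) X + a with B valued in F_(2^m)
-- and, like L, invariant under translation by F_(2^m).  Such a map is injective when
-- 1 + c is a nonzero element of F_(2^m), and an injective map of a finite field hits
-- every b exactly once.
module Submission where

open import Defs
open import Level using (0ℓ)
open import Data.Nat as ℕ using (ℕ; zero; suc; s≤s; z≤n)
import Data.Nat.Properties as ℕ
open import Data.Fin using (Fin; zero; suc; punchIn; punchOut)
open import Data.Fin.Properties
  using (any?; 0≢1+n; suc-injective; punchOut-injective; punchInᵢ≢i; injective⇒≤; nonZeroIndex)
  renaming (_≟_ to _≟ᶠ_)
open import Data.Fin.Permutation using (Permutation)
open import Data.List using (List; []; _∷_; filter; length; tabulate; map; foldr; concatMap; allFin)
import Data.List.Properties as List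
import Data.List.Relation.Unary.All as All
import Data.List.Relation.Unary.All.Properties as All
open import Data.Product using (∃; _,_)
open import Function.Base using (_∘_; id)
open import Function.Bundles using (_↔_; Inverse; mk↔ₛ′)
open import Function.Construct.Composition using (_↔-∘_)
open import Function.Construct.Symmetry using (↔-sym)
open import Function.Definitions using (Injective)
open import Relation.Nullary using (yes; no; contradiction)
open import Relation.Unary using (Decidable)
open import Relation.Binary.PropositionalEquality
open import Algebra.Bundles using (CommutativeRing)
import Algebra.Properties.Ring
import Algebra.Properties.CommutativeMonoid.Sum
import Algebra.Properties.CommutativeMonoid.Mult

module _ {A : Set} {P : A → Set} (P? : Decidable P) where

  length-filter-tabulate-unique : ∀ {n} (f : Fin n → A) (i : Fin n) →
    P (f i) → (∀ j → P (f j) → j ≡ i) → length (filter P? (tabulate f)) ≡ 1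
  length-filter-tabulate-unique f zero pᵢ unique with P? (f zero)
  ... | yes _ = cong (suc ∘ length)
          (List.filter-none P? (All.tabulate⁺ λ j pⱼ → 0≢1+n (sym (unique (suc j) pⱼ))))
  ... | no ¬p₀ = contradiction pᵢ ¬p₀
  length-filter-tabulate-unique f (suc i) pᵢ unique with P? (f zero)
  ... | yes p₀ = contradiction (unique zero p₀) 0≢1+n
  ... | no _ = length-filter-tabulate-unique (f ∘ suc) i pᵢ
          (λ j pⱼ → suc-injective (unique (suc j) pⱼ))

Fin-injective⇒surjective : ∀ {n} (g : Fin n → Fin n) → Injective _≡_ _≡_ g →
  ∀ j → ∃ λ i → g i ≡ j
Fin-injective⇒surjective {suc n} g g-inj j with any? (λ i → g i ≟ᶠ j)
... | yes hit = hit
... | no miss = contradiction (injective⇒≤ squeeze-injective) ℕ.1+n≰n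
  where
  j≢g : ∀ i → j ≢ g i
  j≢g i j≡gi = miss (i , sym j≡gi)

  squeeze : Fin (suc n) → Fin n
  squeeze i = punchOut (j≢g i)

  squeeze-injective : Injective _≡_ _≡_ squeeze
  squeeze-injective {x} {y} eq = g-inj (punchOut-injective (j≢g x) (j≢g y) eq)

foldr-⊔-≡1 : ∀ {B : Set} (s : B → ℕ → ℕ) → (∀ p n → s p n ≡ 1 ℕ.⊔ n) →
  ∀ xs → 1 ℕ.≤ length xs → foldr s 0 xs ≡ 1
foldr-⊔-≡1 s s≡1⊔ (x ∷ []) _ = s≡1⊔ x 0
foldr-⊔-≡1 s s≡1⊔ (x ∷ xs@(_ ∷ _)) _ = trans (s≡1⊔ x _) (cong (1 ℕ.⊔_) (foldr-⊔-≡1 s s≡1⊔ xs (s≤s z≤n)))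

pairs-nonempty : ∀ {A B : Set} (xs : List A) (ys : List B) →
  1 ℕ.≤ length xs → 1 ℕ.≤ length ys → 1 ℕ.≤ length (concatMap (λ a → map (a ,_) ys) xs)
pairs-nonempty (_ ∷ _) (_ ∷ _) _ _ = s≤s z≤n

module FiniteFieldProperties {q : ℕ} (K : FiniteField q) where
  open FiniteField K

  commutativeRing : CommutativeRing 0ℓ 0ℓ
  commutativeRing = record { isCommutativeRing = isCommutativeRing }

  open CommutativeRing commutativeRing public
    using ( +-identityˡ; +-identityʳ; -‿inverseʳ
          ; *-assoc; *-comm; *-identityˡ; *-identityʳ; distribˡ; distribʳ; zeroˡ; zeroʳ)
  open Algebra.Properties.Ring (CommutativeRing.ring commutativeRing) public
    using (-1*x≈-x; -‿involutive; +-cancelʳ; +-inverseˡ-unique)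
  open import Algebra.Solver.Ring.NaturalCoefficients.Default
    (CommutativeRing.commutativeSemiring commutativeRing) public

  private
    module Prod = Algebra.Properties.CommutativeMonoid.Sum
      (CommutativeRing.*-commutativeMonoid commutativeRing)
    module Pow = Algebra.Properties.CommutativeMonoid.Mult
      (CommutativeRing.*-commutativeMonoid commutativeRing)
    open ≡-Reasoning

  ^≡× : ∀ x n → x ^ n ≡ n Pow.× x
  ^≡× x zero = refl
  ^≡× x (suc n) = cong (x *_) (^≡× x n)

  ^-homo-* : ∀ x m n → x ^ (m ℕ.+ n) ≡ x ^ m * x ^ n
  ^-homo-* x m n rewrite ^≡× x (m ℕ.+ n) | ^≡× x m | ^≡× x n = Pow.×-homo-+ x m n

  ^-assocʳ : ∀ x m n → (x ^ m) ^ n ≡ x ^ (m ℕ.* n)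
  ^-assocʳ x m n rewrite ^≡× (x ^ m) n | ^≡× x m | ^≡× x (m ℕ.* n) =
    trans (Pow.×-assocˡ x n m) (cong (Pow._× x) (ℕ.*-comm n m))

  ^-distrib-* : ∀ x y n → (x * y) ^ n ≡ x ^ n * y ^ n
  ^-distrib-* x y n rewrite ^≡× (x * y) n | ^≡× x n | ^≡× y n = Pow.×-distrib-+ x y n

  1^n≡1 : ∀ n → 1# ^ n ≡ 1#
  1^n≡1 n = trans (^≡× 1# n) (trans (sym (Prod.sum-replicate n)) (Prod.sum-replicate-zero n))

  0^n≡0 : ∀ n → .{{ℕ.NonZero n}} → 0# ^ n ≡ 0#
  0^n≡0 (suc n) = zeroˡ _

  x^2≡x*x : ∀ x → x ^ 2 ≡ x * x
  x^2≡x*x x = cong (x *_) (*-identityʳ x)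

  *-cancelʳ-≢0 : ∀ {x y} z → z ≢ 0# → x * z ≡ y * z → x ≡ y
  *-cancelʳ-≢0 {x} {y} z z≢0 xz≡yz with inverse z z≢0
  ... | z⁻¹ , zz⁻¹≡1 = begin
    x             ≡⟨ sym (*-identityʳ x) ⟩
    x * 1#        ≡⟨ cong (x *_) (sym zz⁻¹≡1) ⟩
    x * (z * z⁻¹) ≡⟨ sym (*-assoc x z z⁻¹) ⟩
    x * z * z⁻¹   ≡⟨ cong (_* z⁻¹) xz≡yz ⟩
    y * z * z⁻¹   ≡⟨ *-assoc y z z⁻¹ ⟩
    y * (z * z⁻¹) ≡⟨ cong (y *_) zz⁻¹≡1 ⟩
    y * 1#        ≡⟨ *-identityʳ y ⟩
    y             ∎

  *-≢0 : ∀ {x y} → x ≢ 0# → y ≢ 0# → x * y ≢ 0#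
  *-≢0 {x} {y} x≢0 y≢0 xy≡0 = x≢0 (*-cancelʳ-≢0 y y≢0 (trans xy≡0 (sym (zeroˡ y))))

  private
    e : Fin q → Carrier
    e = Inverse.to enum

    e⁻¹ : Carrier → Fin q
    e⁻¹ = Inverse.from enum

    e∘e⁻¹ : ∀ x → e (e⁻¹ x) ≡ x
    e∘e⁻¹ = Inverse.strictlyInverseˡ enum

    e⁻¹∘e : ∀ i → e⁻¹ (e i) ≡ i
    e⁻¹∘e = Inverse.strictlyInverseʳ enum

    e-injective : ∀ {i j} → e i ≡ e j → i ≡ j
    e-injective {i} {j} eq = trans (sym (e⁻¹∘e i)) (trans (cong e⁻¹ eq) (e⁻¹∘e j))

    e⁻¹-injective : ∀ {x y} → e⁻¹ x ≡ e⁻¹ y → x ≡ y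
    e⁻¹-injective {x} {y} eq = trans (sym (e∘e⁻¹ x)) (trans (cong e eq) (e∘e⁻¹ y))

  ∏ : ∀ {n} → (Fin n → Carrier) → Carrier
  ∏ = Prod.sum

  ∏-const : ∀ n x → ∏ {n} (λ _ → x) ≡ x ^ n
  ∏-const n x = trans (Prod.sum-replicate n) (sym (^≡× x n))

  ∏-single : ∀ {n} (t : Fin n → Carrier) (i : Fin n) → (∀ j → j ≢ i → t j ≡ 1#) → ∏ t ≡ t i
  ∏-single {suc n} t i t≡1 = begin
    ∏ t                              ≡⟨ Prod.sum-remove t ⟩
    t i * ∏ (λ j → t (punchIn i j))  ≡⟨ cong (t i *_) (Prod.sum-cong-≗ λ j → t≡1 _ (punchInᵢ≢i i j)) ⟩
    t i * ∏ {n} (λ _ → 1#)           ≡⟨ cong (t i *_) (Prod.sum-replicate-zero n) ⟩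
    t i * 1#                         ≡⟨ *-identityʳ (t i) ⟩
    t i                              ∎

  ∏-≢0 : ∀ {n} (t : Fin n → Carrier) → (∀ i → t i ≢ 0#) → ∏ t ≢ 0#
  ∏-≢0 {zero} t _ 1≡0 = 0≢1 (sym 1≡0)
  ∏-≢0 {suc n} t t≢0 = *-≢0 (t≢0 zero) (∏-≢0 (t ∘ suc) (t≢0 ∘ suc))

  ∏-reindex : (g : Carrier ↔ Carrier) (f : Carrier → Carrier) →
    ∏ (f ∘ e) ≡ ∏ (f ∘ Inverse.to g ∘ e)
  ∏-reindex g f = trans (Prod.sum-permute (f ∘ e) π) (Prod.sum-cong-≗ {q} λ i → cong f (e∘e⁻¹ _))
    where
    π : Permutation q q
    π = ↔-sym enum ↔-∘ (g ↔-∘ enum)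

  scaling-↔ : ∀ {x} → x ≢ 0# → Carrier ↔ Carrier
  scaling-↔ {x} x≢0 with inverse x x≢0
  ... | x⁻¹ , xx⁻¹≡1 = mk↔ₛ′ (x *_) (x⁻¹ *_) (cancel x x⁻¹ xx⁻¹≡1) (cancel x⁻¹ x (trans (*-comm x⁻¹ x) xx⁻¹≡1))
    where
    cancel : ∀ a b → a * b ≡ 1# → ∀ y → a * (b * y) ≡ y
    cancel a b ab≡1 y = trans (sym (*-assoc a b y)) (trans (cong (_* y) ab≡1) (*-identityˡ y))

  ifZero : Carrier → Carrier → Carrier → Carrier
  ifZero y a b with y ≟ 0#
  ... | yes _ = a
  ... | no _ = b

  ifZero-0 : ∀ a b → ifZero 0# a b ≡ a
  ifZero-0 a b with 0# ≟ 0#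
  ... | yes _ = refl
  ... | no 0≢0 = contradiction refl 0≢0

  ifZero-≢0 : ∀ {y} a b → y ≢ 0# → ifZero y a b ≡ b
  ifZero-≢0 {y} a b y≢0 with y ≟ 0#
  ... | yes y≡0 = contradiction y≡0 y≢0
  ... | no _ = refl

  -- ∏ (x * unit y) over all y is x^q U directly and U x after reindexing along y ↦ x y;
  -- unit y replaces 0 by 1, so that U ≠ 0 and no q - 1 appears.
  fermat : ∀ x → x ^ q ≡ x
  fermat x with x ≟ 0#
  ... | yes refl = 0^n≡0 q {{nonZeroIndex (e⁻¹ 0#)}}
  ... | no x≢0 = *-cancelʳ-≢0 U (∏-≢0 (unit ∘ e) λ i → unit-≢0 (e i)) (begin
    x ^ q * U                                   ≡⟨ cong (_* U) (sym (∏-const q x)) ⟩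
    ∏ {q} (λ _ → x) * U                          ≡⟨ sym (Prod.∑-distrib-+ (λ _ → x) (unit ∘ e)) ⟩
    ∏ (λ i → x * unit (e i))                     ≡⟨ Prod.sum-cong-≗ (scale-unit ∘ e) ⟩
    ∏ (λ i → unit (x * e i) * ifZero (e i) x 1#) ≡⟨ Prod.∑-distrib-+ (unit ∘ (x *_) ∘ e) _ ⟩
    ∏ (unit ∘ (x *_) ∘ e) * ∏ (λ i → ifZero (e i) x 1#)
      ≡⟨ cong₂ _*_ (sym (∏-reindex (scaling-↔ x≢0) unit)) (∏-single _ (e⁻¹ 0#) ifZero-away) ⟩
    U * ifZero (e (e⁻¹ 0#)) x 1#                 ≡⟨ cong (λ z → U * ifZero z x 1#) (e∘e⁻¹ 0#) ⟩
    U * ifZero 0# x 1#                           ≡⟨ cong (U *_) (ifZero-0 x 1#) ⟩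
    U * x                                        ≡⟨ *-comm U x ⟩
    x * U                                        ∎)
    where
    unit : Carrier → Carrier
    unit y = ifZero y 1# y

    unit-≢0 : ∀ y → unit y ≢ 0#
    unit-≢0 y with y ≟ 0#
    ... | yes _ = λ 1≡0 → 0≢1 (sym 1≡0)
    ... | no y≢0 = y≢0

    U : Carrier
    U = ∏ (unit ∘ e)

    scale-unit : ∀ y → x * unit y ≡ unit (x * y) * ifZero y x 1#
    scale-unit y with y ≟ 0#
    ... | yes refl = begin
      x * 1#                       ≡⟨ *-comm x 1# ⟩
      1# * x                       ≡⟨ cong (_* x) (sym (ifZero-0 1# 0#)) ⟩
      unit 0# * x                  ≡⟨ cong (λ z → unit z * x) (sym (zeroʳ x)) ⟩
      unit (x * 0#) * x            ∎
    ... | no y≢0 = begin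
      x * y                        ≡⟨ sym (*-identityʳ (x * y)) ⟩
      x * y * 1#                   ≡⟨ cong (_* 1#) (sym (ifZero-≢0 1# (x * y) (*-≢0 x≢0 y≢0))) ⟩
      unit (x * y) * 1#            ∎

    ifZero-away : ∀ j → j ≢ e⁻¹ 0# → ifZero (e j) x 1# ≡ 1#
    ifZero-away j j≢ = ifZero-≢0 x 1# λ ej≡0 → j≢ (trans (sym (e⁻¹∘e j)) (cong e⁻¹ ej≡0))

  even-order⇒1+1≡0 : (∃ λ r → q ≡ 2 ℕ.* r) → 1# + 1# ≡ 0#
  even-order⇒1+1≡0 (r , q≡2r) = trans (cong (1# +_) (sym -1≡1)) (-‿inverseʳ 1#)
    where
    -1≡1 : - 1# ≡ 1#
    -1≡1 = begin
      - 1#                     ≡⟨ sym (fermat (- 1#)) ⟩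
      (- 1#) ^ q               ≡⟨ cong ((- 1#) ^_) q≡2r ⟩
      (- 1#) ^ (2 ℕ.* r)       ≡⟨ sym (^-assocʳ (- 1#) 2 r) ⟩
      ((- 1#) ^ 2) ^ r         ≡⟨ cong (_^ r) (x^2≡x*x (- 1#)) ⟩
      ((- 1#) * (- 1#)) ^ r    ≡⟨ cong (_^ r) (trans (-1*x≈-x (- 1#)) (-‿involutive 1#)) ⟩
      1# ^ r                   ≡⟨ 1^n≡1 r ⟩
      1#                       ∎

  injective⇒surjective : (G : Carrier → Carrier) → Injective _≡_ _≡_ G → ∀ b → ∃ λ x → G x ≡ b
  injective⇒surjective G G-inj b
    with Fin-injective⇒surjective (e⁻¹ ∘ G ∘ e) (e-injective ∘ G-inj ∘ e⁻¹-injective) (e⁻¹ b)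
  ... | i , g[i]≡b = e i , e⁻¹-injective g[i]≡b

  countSol-injective : (G : Carrier → Carrier) → Injective _≡_ _≡_ G → ∀ b → countSol G b ≡ 1
  countSol-injective G G-inj b with injective⇒surjective G G-inj b
  ... | x , Gx≡b = trans (cong (length ∘ filter (λ X → G X ≟ b)) (List.map-tabulate id e))
    (length-filter-tabulate-unique (λ X → G X ≟ b) e (e⁻¹ x) (trans (cong G (e∘e⁻¹ x)) Gx≡b)
      λ j G[ej]≡b → trans (sym (e⁻¹∘e j)) (cong e⁻¹ (G-inj (trans G[ej]≡b (sym Gx≡b)))))

  elements-nonempty : 1 ℕ.≤ length elements
  elements-nonempty = ℕ.≤-trans (Fin-inhabited⇒1≤ (e⁻¹ 0#))
    (ℕ.≤-reflexive (sym (trans (List.length-map e (allFin q)) (List.length-tabulate {n = q} id))))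
    where
    Fin-inhabited⇒1≤ : ∀ {n} → Fin n → 1 ℕ.≤ n
    Fin-inhabited⇒1≤ {suc _} _ = s≤s z≤n

  injective⇒PcN : ∀ F c → c ≢ 1# → (∀ a → Injective _≡_ _≡_ (λ X → F (X + a) - c * F X)) → PcN F c
  injective⇒PcN F c c≢1 Δ-inj =
    foldr-⊔-≡1 _ (λ { (a , b) n → cong (ℕ._⊔ n) (countSol-injective _ (Δ-inj a) b) }) (admissible c)
      (subst (λ as → 1 ℕ.≤ length (concatMap (λ a → map (a ,_) elements) as))
        (sym (List.filter-all _ (All.universal (λ _ (c≡1 , _) → c≢1 c≡1) elements)))
        (pairs-nonempty elements elements elements-nonempty elements-nonempty))

module CharacteristicTwo {q : ℕ} (K : FiniteField q)
  (1+1≡0 : FiniteField._+_ K (FiniteField.1# K) (FiniteField.1# K) ≡ FiniteField.0# K) where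
  open FiniteField K
  open FiniteFieldProperties K
  open ≡-Reasoning

  x+x≡0 : ∀ x → x + x ≡ 0#
  x+x≡0 x = begin
    x + x            ≡⟨ cong₂ _+_ (sym (*-identityˡ x)) (sym (*-identityˡ x)) ⟩
    1# * x + 1# * x  ≡⟨ sym (distribʳ x 1# 1#) ⟩
    (1# + 1#) * x    ≡⟨ cong (_* x) 1+1≡0 ⟩
    0# * x           ≡⟨ zeroˡ x ⟩
    0#               ∎

  x+[y+y]≡x : ∀ x y → x + (y + y) ≡ x
  x+[y+y]≡x x y = trans (cong (x +_) (x+x≡0 y)) (+-identityʳ x)

  -x≡x : ∀ x → - x ≡ x
  -x≡x x = sym (+-inverseˡ-unique x x (x+x≡0 x))

  x+y≡0⇒x≡y : ∀ {x y} → x + y ≡ 0# → x ≡ y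
  x+y≡0⇒x≡y {x} {y} x+y≡0 = trans (+-inverseˡ-unique x y x+y≡0) (-x≡x y)

  +-exchange : ∀ {a b c d} → a + b ≡ c + d → b + d ≡ a + c
  +-exchange {a} {b} {c} {d} eq = begin
    b + d              ≡⟨ sym (x+[y+y]≡x (b + d) a) ⟩
    (b + d) + (a + a)  ≡⟨ solve 3 (λ a b d → (b :+ d) :+ (a :+ a) := (a :+ b) :+ (a :+ d)) refl a b d ⟩
    (a + b) + (a + d)  ≡⟨ cong (_+ (a + d)) eq ⟩
    (c + d) + (a + d)  ≡⟨ solve 3 (λ a c d → (c :+ d) :+ (a :+ d) := (a :+ c) :+ (d :+ d)) refl a c d ⟩
    (a + c) + (d + d)  ≡⟨ x+[y+y]≡x (a + c) d ⟩
    a + c              ∎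

  [x+y]^2≡x^2+y^2 : ∀ x y → (x + y) ^ 2 ≡ x ^ 2 + y ^ 2
  [x+y]^2≡x^2+y^2 x y = begin
    (x + y) ^ 2                        ≡⟨ x^2≡x*x (x + y) ⟩
    (x + y) * (x + y)                  ≡⟨ solve 2 (λ x y → (x :+ y) :* (x :+ y) := (x :* x :+ y :* y) :+ (x :* y :+ x :* y)) refl x y ⟩
    (x * x + y * y) + (x * y + x * y)  ≡⟨ x+[y+y]≡x _ (x * y) ⟩
    x * x + y * y                      ≡⟨ sym (cong₂ _+_ (x^2≡x*x x) (x^2≡x*x y)) ⟩
    x ^ 2 + y ^ 2                      ∎

  frobenius : ∀ k x y → (x + y) ^ (2 ℕ.^ k) ≡ x ^ (2 ℕ.^ k) + y ^ (2 ℕ.^ k)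
  frobenius zero x y = trans (*-identityʳ (x + y)) (sym (cong₂ _+_ (*-identityʳ x) (*-identityʳ y)))
  frobenius (suc k) x y = begin
    (x + y) ^ (2 ℕ.* 2 ℕ.^ k)                ≡⟨ sym (^-assocʳ (x + y) 2 (2 ℕ.^ k)) ⟩
    ((x + y) ^ 2) ^ (2 ℕ.^ k)                ≡⟨ cong (_^ (2 ℕ.^ k)) ([x+y]^2≡x^2+y^2 x y) ⟩
    (x ^ 2 + y ^ 2) ^ (2 ℕ.^ k)              ≡⟨ frobenius k (x ^ 2) (y ^ 2) ⟩
    (x ^ 2) ^ (2 ℕ.^ k) + (y ^ 2) ^ (2 ℕ.^ k) ≡⟨ cong₂ _+_ (^-assocʳ x 2 (2 ℕ.^ k)) (^-assocʳ y 2 (2 ℕ.^ k)) ⟩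
    x ^ (2 ℕ.* 2 ℕ.^ k) + y ^ (2 ℕ.* 2 ℕ.^ k) ∎

2^[3m]-even : ∀ m → 1 ℕ.≤ m → ∃ λ r → 2 ℕ.^ (3 ℕ.* m) ≡ 2 ℕ.* r
2^[3m]-even (suc m) _ = 2 ℕ.^ (m ℕ.+ 2 ℕ.* suc m) , refl

module CubicExtension (m : ℕ) (m≥1 : 1 ℕ.≤ m) (K : FiniteField (2 ℕ.^ (3 ℕ.* m))) where
  open FiniteField K
  open FiniteFieldProperties K
  open CharacteristicTwo K (even-order⇒1+1≡0 (2^[3m]-even m m≥1))
  open ≡-Reasoning

  Q : ℕ
  Q = 2 ℕ.^ m

  σ : Carrier → Carrier
  σ x = x ^ Q

  σ-+ : ∀ x y → σ (x + y) ≡ σ x + σ y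
  σ-+ = frobenius m

  σ-* : ∀ x y → σ (x * y) ≡ σ x * σ y
  σ-* x y = ^-distrib-* x y Q

  x^[2^[k+1]] : ∀ x k → x ^ (2 ℕ.^ (k ℕ.+ 1)) ≡ x ^ (2 ℕ.^ k) * x ^ (2 ℕ.^ k)
  x^[2^[k+1]] x k = begin
    x ^ (2 ℕ.^ (k ℕ.+ 1))  ≡⟨ cong (x ^_) (ℕ.^-distribˡ-+-* 2 k 1) ⟩
    x ^ (2 ℕ.^ k ℕ.* 2)    ≡⟨ sym (^-assocʳ x (2 ℕ.^ k) 2) ⟩
    (x ^ (2 ℕ.^ k)) ^ 2    ≡⟨ x^2≡x*x _ ⟩
    x ^ (2 ℕ.^ k) * x ^ (2 ℕ.^ k) ∎

  x^[2^[2m]]≡σ²x : ∀ x → x ^ (2 ℕ.^ (2 ℕ.* m)) ≡ σ (σ x)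
  x^[2^[2m]]≡σ²x x = begin
    x ^ (2 ℕ.^ (m ℕ.+ (m ℕ.+ 0)))  ≡⟨ cong (x ^_) (ℕ.^-distribˡ-+-* 2 m (m ℕ.+ 0)) ⟩
    x ^ (Q ℕ.* 2 ℕ.^ (m ℕ.+ 0))    ≡⟨ cong (λ k → x ^ (Q ℕ.* 2 ℕ.^ k)) (ℕ.+-identityʳ m) ⟩
    x ^ (Q ℕ.* Q)                  ≡⟨ sym (^-assocʳ x Q Q) ⟩
    σ (σ x)                        ∎

  σ³≡id : ∀ x → σ (σ (σ x)) ≡ x
  σ³≡id x = begin
    σ (σ (σ x))                      ≡⟨ cong σ (sym (x^[2^[2m]]≡σ²x x)) ⟩
    σ (x ^ (2 ℕ.^ (2 ℕ.* m)))        ≡⟨ ^-assocʳ x (2 ℕ.^ (2 ℕ.* m)) Q ⟩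
    x ^ (2 ℕ.^ (2 ℕ.* m) ℕ.* Q)      ≡⟨ cong (x ^_) (sym (ℕ.^-distribˡ-+-* 2 (2 ℕ.* m) m)) ⟩
    x ^ (2 ℕ.^ (2 ℕ.* m ℕ.+ m))      ≡⟨ cong (λ k → x ^ (2 ℕ.^ k)) (ℕ.+-comm (2 ℕ.* m) m) ⟩
    x ^ (2 ℕ.^ (3 ℕ.* m))            ≡⟨ fermat x ⟩
    x                                ∎

  Tr≡ : ∀ x → Tr m x ≡ x + σ x + σ (σ x)
  Tr≡ x = cong (x + σ x +_) (x^[2^[2m]]≡σ²x x)

  Tr-+ : ∀ x y → Tr m (x + y) ≡ Tr m x + Tr m y
  Tr-+ x y = begin
    Tr m (x + y)                                      ≡⟨ Tr≡ (x + y) ⟩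
    (x + y) + σ (x + y) + σ (σ (x + y))
      ≡⟨ cong₂ (λ s t → (x + y) + s + t) (σ-+ x y) (trans (cong σ (σ-+ x y)) (σ-+ (σ x) (σ y))) ⟩
    (x + y) + (σ x + σ y) + (σ (σ x) + σ (σ y))
      ≡⟨ solve 6 (λ x y sx sy ssx ssy → (x :+ y) :+ (sx :+ sy) :+ (ssx :+ ssy)
                                       := (x :+ sx :+ ssx) :+ (y :+ sy :+ ssy))
           refl x y (σ x) (σ y) (σ (σ x)) (σ (σ y)) ⟩
    (x + σ x + σ (σ x)) + (y + σ y + σ (σ y))         ≡⟨ sym (cong₂ _+_ (Tr≡ x) (Tr≡ y)) ⟩
    Tr m x + Tr m y                                   ∎

  Tr-σ : ∀ x → Tr m (σ x) ≡ Tr m x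
  Tr-σ x = begin
    Tr m (σ x)                    ≡⟨ Tr≡ (σ x) ⟩
    σ x + σ (σ x) + σ (σ (σ x))   ≡⟨ cong (σ x + σ (σ x) +_) (σ³≡id x) ⟩
    σ x + σ (σ x) + x             ≡⟨ solve 3 (λ x sx ssx → sx :+ ssx :+ x := x :+ sx :+ ssx) refl x (σ x) (σ (σ x)) ⟩
    x + σ x + σ (σ x)             ≡⟨ sym (Tr≡ x) ⟩
    Tr m x                        ∎

  L : Carrier → Carrier → Carrier
  L δ X = σ X + X + δ

  Tr-L : ∀ δ X → Tr m (L δ X) ≡ Tr m δ
  Tr-L δ X = begin
    Tr m (σ X + X + δ)               ≡⟨ trans (Tr-+ (σ X + X) δ) (cong (_+ Tr m δ) (Tr-+ (σ X) X)) ⟩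
    Tr m (σ X) + Tr m X + Tr m δ     ≡⟨ cong (λ t → t + Tr m X + Tr m δ) (Tr-σ X) ⟩
    Tr m X + Tr m X + Tr m δ         ≡⟨ cong (_+ Tr m δ) (x+x≡0 (Tr m X)) ⟩
    0# + Tr m δ                      ≡⟨ +-identityˡ (Tr m δ) ⟩
    Tr m δ                           ∎

  L-periodic : ∀ δ {u} → InSub m u → ∀ X → L δ (X + u) ≡ L δ X
  L-periodic δ {u} σu≡u X = begin
    σ (X + u) + (X + u) + δ      ≡⟨ cong (λ s → s + (X + u) + δ) (trans (σ-+ X u) (cong (σ X +_) σu≡u)) ⟩
    (σ X + u) + (X + u) + δ
      ≡⟨ solve 4 (λ sX X u δ → (sX :+ u) :+ (X :+ u) :+ δ := (sX :+ X :+ δ) :+ (u :+ u)) refl (σ X) X u δ ⟩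
    (σ X + X + δ) + (u + u)      ≡⟨ x+[y+y]≡x _ u ⟩
    σ X + X + δ                  ∎

  P : Carrier → Carrier
  P y = σ (σ y) * σ (σ y) * σ y + σ y * σ y * σ (σ y)

  thmF≡P∘L+id : ∀ δ X → thmF K m δ X ≡ P (L δ X) + X
  thmF≡P∘L+id δ X = cong (_+ X) (cong₂ _+_ first second)
    where
    l = L δ X
    first : l ^ (2 ℕ.^ (2 ℕ.* m ℕ.+ 1) ℕ.+ Q) ≡ σ (σ l) * σ (σ l) * σ l
    first = begin
      l ^ (2 ℕ.^ (2 ℕ.* m ℕ.+ 1) ℕ.+ Q)   ≡⟨ ^-homo-* l (2 ℕ.^ (2 ℕ.* m ℕ.+ 1)) Q ⟩
      l ^ (2 ℕ.^ (2 ℕ.* m ℕ.+ 1)) * σ l   ≡⟨ cong (_* σ l) (x^[2^[k+1]] l (2 ℕ.* m)) ⟩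
      l ^ (2 ℕ.^ (2 ℕ.* m)) * l ^ (2 ℕ.^ (2 ℕ.* m)) * σ l
        ≡⟨ cong (λ s → s * s * σ l) (x^[2^[2m]]≡σ²x l) ⟩
      σ (σ l) * σ (σ l) * σ l              ∎
    second : l ^ (2 ℕ.^ (2 ℕ.* m) ℕ.+ 2 ℕ.^ (m ℕ.+ 1)) ≡ σ l * σ l * σ (σ l)
    second = begin
      l ^ (2 ℕ.^ (2 ℕ.* m) ℕ.+ 2 ℕ.^ (m ℕ.+ 1))            ≡⟨ ^-homo-* l (2 ℕ.^ (2 ℕ.* m)) (2 ℕ.^ (m ℕ.+ 1)) ⟩
      l ^ (2 ℕ.^ (2 ℕ.* m)) * l ^ (2 ℕ.^ (m ℕ.+ 1))        ≡⟨ cong₂ _*_ (x^[2^[2m]]≡σ²x l) (x^[2^[k+1]] l m) ⟩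
      σ (σ l) * (σ l * σ l)                                ≡⟨ *-comm (σ (σ l)) (σ l * σ l) ⟩
      σ l * σ l * σ (σ l)                                  ∎

  -- With s = σ y and b = σ² y, trace zero means s = y + b; substituting it, P y
  -- becomes the expression y² b + b² y, which σ visibly fixes (σ y = s, σ b = y).
  P-fixed : ∀ y → Tr m y ≡ 0# → InSub m (P y)
  P-fixed y Tr[y]≡0 = begin
    σ (P y)                                  ≡⟨ σ-+ (b * b * s) (s * s * b) ⟩
    σ (b * b * s) + σ (s * s * b)            ≡⟨ cong₂ _+_ (σ-*³ b b s) (σ-*³ s s b) ⟩
    σ b * σ b * σ s + σ s * σ s * σ b        ≡⟨ cong (λ t → t * t * b + b * b * t) (σ³≡id y) ⟩
    y * y * b + b * b * y                    ≡⟨ sym (x+[y+y]≡x _ (b * b * y + b * b * b)) ⟩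
    (y * y * b + b * b * y) + ((b * b * y + b * b * b) + (b * b * y + b * b * b))
      ≡⟨ solve 2 (λ y b → (y :* y :* b :+ b :* b :* y) :+ ((b :* b :* y :+ b :* b :* b) :+ (b :* b :* y :+ b :* b :* b))
                       := b :* b :* (y :+ b) :+ (y :+ b) :* (y :+ b) :* b) refl y b ⟩
    b * b * (y + b) + (y + b) * (y + b) * b  ≡⟨ cong (λ t → b * b * t + t * t * b) (sym s≡y+b) ⟩
    P y                                      ∎
    where
    s = σ y
    b = σ (σ y)
    σ-*³ : ∀ x y z → σ (x * y * z) ≡ σ x * σ y * σ z
    σ-*³ x y z = trans (σ-* (x * y) z) (cong (_* σ z) (σ-* x y))
    s≡y+b : s ≡ y + b
    s≡y+b = x+y≡0⇒x≡y (begin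
      s + (y + b)      ≡⟨ solve 3 (λ y s b → s :+ (y :+ b) := y :+ s :+ b) refl y s b ⟩
      y + s + b        ≡⟨ sym (Tr≡ y) ⟩
      Tr m y           ≡⟨ Tr[y]≡0 ⟩
      0#               ∎)

  -- If B(X) + d X = B(Y) + d Y then d (X + Y) = B(X) + B(Y) lies in F_{2^m}, hence so
  -- does u = X + Y; translating by u does not change B, so d u = 0.
  fixed+linear-injective : (B : Carrier → Carrier) → (∀ X → InSub m (B X)) →
    (∀ {u} → InSub m u → ∀ X → B (X + u) ≡ B X) →
    ∀ {d} → InSub m d → d ≢ 0# → Injective _≡_ _≡_ (λ X → B X + d * X)
  fixed+linear-injective B B-fixed B-periodic {d} d-fixed d≢0 {X} {Y} eq = x+y≡0⇒x≡y u≡0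
    where
    u = X + Y
    du≡BX+BY : d * u ≡ B X + B Y
    du≡BX+BY = trans (distribˡ d X Y) (+-exchange eq)
    u-fixed : InSub m u
    u-fixed = *-cancelʳ-≢0 d d≢0 (begin
      σ u * d            ≡⟨ *-comm (σ u) d ⟩
      d * σ u            ≡⟨ cong (_* σ u) (sym d-fixed) ⟩
      σ d * σ u          ≡⟨ sym (σ-* d u) ⟩
      σ (d * u)          ≡⟨ cong σ du≡BX+BY ⟩
      σ (B X + B Y)      ≡⟨ trans (σ-+ (B X) (B Y)) (cong₂ _+_ (B-fixed X) (B-fixed Y)) ⟩
      B X + B Y          ≡⟨ sym du≡BX+BY ⟩
      d * u              ≡⟨ *-comm d u ⟩
      u * d              ∎)
    X≡Y+u : X ≡ Y + u
    X≡Y+u = trans (sym (x+[y+y]≡x X Y)) (solve 2 (λ X Y → X :+ (Y :+ Y) := Y :+ (X :+ Y)) refl X Y)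
    u≡0 : u ≡ 0#
    u≡0 = *-cancelʳ-≢0 d d≢0 (begin
      u * d              ≡⟨ *-comm u d ⟩
      d * u              ≡⟨ du≡BX+BY ⟩
      B X + B Y          ≡⟨ cong (λ Z → B Z + B Y) X≡Y+u ⟩
      B (Y + u) + B Y    ≡⟨ cong (_+ B Y) (B-periodic u-fixed Y) ⟩
      B Y + B Y          ≡⟨ x+x≡0 (B Y) ⟩
      0#                 ≡⟨ sym (zeroˡ d) ⟩
      0# * d             ∎)

  module Derivative (δ : Carrier) (Tr[δ]≡0 : Tr m δ ≡ 0#) {c : Carrier} (c-fixed : InSub m c) (a : Carrier) where

    B : Carrier → Carrier
    B X = P (L δ (X + a)) + c * P (L δ X)

    B-fixed : ∀ X → InSub m (B X)
    B-fixed X = begin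
      σ (P (L δ (X + a)) + c * P (L δ X))         ≡⟨ trans (σ-+ _ _) (cong (σ (P (L δ (X + a))) +_) (σ-* c _)) ⟩
      σ (P (L δ (X + a))) + σ c * σ (P (L δ X))   ≡⟨ cong₂ _+_ (P∘L-fixed (X + a)) (cong₂ _*_ c-fixed (P∘L-fixed X)) ⟩
      P (L δ (X + a)) + c * P (L δ X)             ∎
      where
      P∘L-fixed : ∀ Z → InSub m (P (L δ Z))
      P∘L-fixed Z = P-fixed (L δ Z) (trans (Tr-L δ Z) Tr[δ]≡0)

    B-periodic : ∀ {u} → InSub m u → ∀ X → B (X + u) ≡ B X
    B-periodic u-fixed X = cong₂ (λ s t → P s + c * P t)
      (trans (cong (L δ) (solve 3 (λ X u a → X :+ u :+ a := X :+ a :+ u) refl X _ a)) (L-periodic δ u-fixed (X + a)))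
      (L-periodic δ u-fixed X)

    derivative≡ : ∀ X → thmF K m δ (X + a) - c * thmF K m δ X ≡ (B X + (1# + c) * X) + a
    derivative≡ X = begin
      thmF K m δ (X + a) - c * thmF K m δ X               ≡⟨ cong (thmF K m δ (X + a) +_) (-x≡x _) ⟩
      thmF K m δ (X + a) + c * thmF K m δ X
        ≡⟨ cong₂ (λ s t → s + c * t) (thmF≡P∘L+id δ (X + a)) (thmF≡P∘L+id δ X) ⟩
      (P (L δ (X + a)) + (X + a)) + c * (P (L δ X) + X)
        ≡⟨ solve 5 (λ p₁ p₂ X a c → (p₁ :+ (X :+ a)) :+ c :* (p₂ :+ X)
                                  := ((p₁ :+ c :* p₂) :+ (con 1 :+ c) :* X) :+ a)
             refl (P (L δ (X + a))) (P (L δ X)) X a c ⟩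
      (B X + (1# + c) * X) + a                            ∎

  derivative-injective : ∀ {δ} → Tr m δ ≡ 0# → ∀ {c} → InSub m c → c ≢ 1# →
    ∀ a → Injective _≡_ _≡_ (λ X → thmF K m δ (X + a) - c * thmF K m δ X)
  derivative-injective {δ} Tr[δ]≡0 {c} c-fixed c≢1 a {X} {Y} eq =
    fixed+linear-injective B B-fixed B-periodic 1+c-fixed 1+c≢0
      (+-cancelʳ a _ _ (trans (sym (derivative≡ X)) (trans eq (derivative≡ Y))))
    where
    open Derivative δ Tr[δ]≡0 c-fixed a
    1+c-fixed : InSub m (1# + c)
    1+c-fixed = trans (σ-+ 1# c) (cong₂ _+_ (1^n≡1 Q) c-fixed)
    1+c≢0 : 1# + c ≢ 0#
    1+c≢0 = c≢1 ∘ sym ∘ x+y≡0⇒x≡y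

open import Data.Nat using (_≤_; _*_; _^_)

theorem3p4 : (m : ℕ) → 1 ≤ m → (K : FiniteField (2 ^ (3 * m))) →
    (δ : FiniteField.Carrier K) → FiniteField.Tr K m δ ≡ FiniteField.0# K →
    (c : FiniteField.Carrier K) → FiniteField.InSub K m c → c ≢ FiniteField.1# K →
    FiniteField.PcN K (thmF K m δ) c
theorem3p4 m m≥1 K δ Tr[δ]≡0 c c-fixed c≢1 =
  FiniteFieldProperties.injective⇒PcN K (thmF K m δ) c c≢1
    (CubicExtension.derivative-injective m m≥1 K Tr[δ]≡0 c-fixed c≢1)
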